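{- Let $k$ be a positive integer, $f(k)$ a non-negative number depending on $k$, and $G$ a graph on $n$ vertices with $n\ge f(k)+k$. If $G$ has a strong $(f(k),k)$-decomposition, then $G$ does not have a $k$-connected subgraph with at least $n-f(k)$ vertices.
   Context: A graph is $k$-connected if it has more than $k$ vertices and has no vertex cut of size at most $k-1$. An $(f(k),k)$-decomposition of a graph $G$ on $n \ge f(k)+k$ vertices is a sequence of triples $(A_i,C_i,D_i)$, $i\in[1,l]$, of vertex sets such that: (1) $V(G)$ is the disjoint union of $A_1,C_1,D_1$; (2) for $i\in[1,l-1]$, $C_i\cup D_i$ is the disjoint union of $A_{i+1},C_{i+1},D_{i+1}$; (3) $|C_i|\le k-1$ for all $i\in[1,l]$; (4) $1\le |A_i|\le |D_i|$ and there is no edge of $G$ between $A_i$ and $D_i$, for all $i\in[1,l]$; (5) $|C_i|+|D_i|\ge n-f(k)$ for $i\in[1,l-1]$; (6) $|C_l|+|D_l|<n-f(k)$. Such a decomposition is strong if $|A_i|+|C_i|<n-f(k)$ for every $i\in[1,l]$. -}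

module Defs where

open import Data.Nat using (ℕ; suc; _+_; _∸_; _≤_; _<_)
open import Data.Fin using (Fin)
open import Data.Fin.Subset using (Subset; _∈_; _∉_; _⊆_; _∩_; _∪_; ∣_∣; ⊥; ⊤)
open import Data.Product using (Σ; _×_)
open import Relation.Binary.PropositionalEquality using (_≡_)
open import Relation.Nullary using (¬_)

record Graph (n : ℕ) : Set₁ where
  field
    Adj   : Fin n → Fin n → Set
    sym   : ∀ {u v} → Adj u v → Adj v u
    irrefl : ∀ {u} → ¬ Adj u u
open Graph public

record Subgraph {n : ℕ} (G : Graph n) : Set₁ where
  field
    V     : Subset n
    E     : Fin n → Fin n → Set
    E⊆    : ∀ {u v} → E u v → u ∈ V × v ∈ V × Adj G u v
    E-sym : ∀ {u v} → E u v → E v u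
open Subgraph public

data Walk {n : ℕ} (E : Fin n → Fin n → Set) (P : Fin n → Set) : Fin n → Fin n → Set where
  here : ∀ {u} → P u → Walk E P u u
  step : ∀ {u v w} → P u → E u v → Walk E P v w → Walk E P u w

IsVertexCut : ∀ {n} {G : Graph n} → Subgraph G → Subset n → Set
IsVertexCut H X =
  X ⊆ V H × Σ _ λ u → Σ _ λ v →
    u ∈ V H × u ∉ X × v ∈ V H × v ∉ X × ¬ Walk (E H) (λ w → w ∉ X) u v

KConnected : ∀ {n} {G : Graph n} → ℕ → Subgraph G → Set
KConnected k H = k < ∣ V H ∣ × (∀ X → IsVertexCut H X → ¬ (∣ X ∣ ≤ k ∸ 1))

DisjointUnion : ∀ {n} → Subset n → Subset n → Subset n → Subset n → Set
DisjointUnion W A C D =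
  (A ∪ C) ∪ D ≡ W × A ∩ C ≡ ⊥ × A ∩ D ≡ ⊥ × C ∩ D ≡ ⊥

-- An (f,k)-decomposition of G (f stands for the number f(k)), given as
-- a length l ≥ 1 and families A,C,D indexed by i ∈ [1,l] (values at other
-- indices are irrelevant).
record Decomposition {n : ℕ} (G : Graph n) (f k : ℕ) : Set₁ where
  field
    l  : ℕ
    1≤l : 1 ≤ l
    A C D : ℕ → Subset n
    c1 : DisjointUnion ⊤ (A 1) (C 1) (D 1)
    c2 : ∀ i → 1 ≤ i → i < l →
           DisjointUnion (C i ∪ D i) (A (suc i)) (C (suc i)) (D (suc i))
    c3 : ∀ i → 1 ≤ i → i ≤ l → ∣ C i ∣ ≤ k ∸ 1
    c4 : ∀ i → 1 ≤ i → i ≤ l →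
           1 ≤ ∣ A i ∣ × ∣ A i ∣ ≤ ∣ D i ∣ ×
           (∀ u v → u ∈ A i → v ∈ D i → ¬ Adj G u v)
    c5 : ∀ i → 1 ≤ i → i < l → n ∸ f ≤ ∣ C i ∣ + ∣ D i ∣
    c6 : ∣ C l ∣ + ∣ D l ∣ < n ∸ f
open Decomposition public

IsStrong : ∀ {n} {G : Graph n} {f k : ℕ} → Decomposition G f k → Set
IsStrong {n} {f = f} Δ =
  ∀ i → 1 ≤ i → i ≤ l Δ → ∣ A Δ i ∣ + ∣ C Δ i ∣ < n ∸ f

-- Suppose H ⊆ G is k-connected with at least n − f vertices.  By induction on i,
-- V(H) ⊆ C_i ∪ D_i: if V(H) ⊆ A ∪ C ∪ D with no A–D edges and |C| ≤ k − 1, then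
-- H cannot meet both A and D (else C ∩ V(H) would be a small vertex cut), it
-- cannot avoid D (else |V(H)| ≤ |A| + |C| < n − f by strongness), so it avoids A.
-- At the last step this gives n − f ≤ |V(H)| ≤ |C_l| + |D_l| < n − f.
module Submission where

open import Defs
open import Data.Nat using (ℕ; suc; _+_; _∸_; _≤_; _<_; s≤s; z≤n)
open import Data.Nat.Properties
  using (≤-refl; ≤-reflexive; ≤-trans; <-≤-trans; <⇒≱; n≤1+n; +-suc; +-monoʳ-≤)
open import Data.Fin using (Fin)
open import Data.Fin.Subset using (Subset; _∈_; _∉_; _⊆_; _∩_; _∪_; ∣_∣; ⊥; ⊤; inside; outside)
open import Data.Fin.Subset.Properties
  using (p⊆q⇒∣p∣≤∣q∣; ∣p∩q∣≤∣p∣; ∉⊥; ∈⊤; x∈p∩q⁺; x∈p∪q⁺; x∈p∪q⁻; p∩q⊆p; p∩q⊆q)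
open import Data.Product using (Σ; _×_; _,_)
open import Data.Sum using (_⊎_; inj₁; inj₂)
open import Data.Vec using ([]; _∷_)
import Data.Empty as Empty
open import Relation.Nullary using (¬_; contradiction)
open import Relation.Binary.PropositionalEquality using (_≡_; subst) renaming (sym to ≡-sym)

∣p∪q∣≤∣p∣+∣q∣ : ∀ {n} (p q : Subset n) → ∣ p ∪ q ∣ ≤ ∣ p ∣ + ∣ q ∣
∣p∪q∣≤∣p∣+∣q∣ []            []            = z≤n
∣p∪q∣≤∣p∣+∣q∣ (inside  ∷ p) (inside  ∷ q) =
  s≤s (≤-trans (∣p∪q∣≤∣p∣+∣q∣ p q) (+-monoʳ-≤ ∣ p ∣ (n≤1+n ∣ q ∣)))
∣p∪q∣≤∣p∣+∣q∣ (inside  ∷ p) (outside ∷ q) = s≤s (∣p∪q∣≤∣p∣+∣q∣ p q)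
∣p∪q∣≤∣p∣+∣q∣ (outside ∷ p) (inside  ∷ q) =
  ≤-trans (s≤s (∣p∪q∣≤∣p∣+∣q∣ p q)) (≤-reflexive (≡-sym (+-suc ∣ p ∣ ∣ q ∣)))
∣p∪q∣≤∣p∣+∣q∣ (outside ∷ p) (outside ∷ q) = ∣p∪q∣≤∣p∣+∣q∣ p q

disjoint⇒∉ : ∀ {n} {x : Fin n} {p q : Subset n} → p ∩ q ≡ ⊥ → x ∈ p → x ∉ q
disjoint⇒∉ {x = x} p∩q≡⊥ x∈p x∈q = ∉⊥ (subst (x ∈_) p∩q≡⊥ (x∈p∩q⁺ (x∈p , x∈q)))

module _ {n : ℕ} {W A C D : Subset n} (W≡A⊎C⊎D : DisjointUnion W A C D) where

  private
    W≡ = let (eq , _) = W≡A⊎C⊎D in eq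

  ∈-disjointUnion⁻ : ∀ {x} → x ∈ W → x ∈ A ⊎ x ∈ C ⊎ x ∈ D
  ∈-disjointUnion⁻ {x} x∈W with x∈p∪q⁻ (A ∪ C) D (subst (x ∈_) (≡-sym W≡) x∈W)
  ... | inj₂ x∈D = inj₂ (inj₂ x∈D)
  ... | inj₁ x∈A∪C with x∈p∪q⁻ A C x∈A∪C
  ...   | inj₁ x∈A = inj₁ x∈A
  ...   | inj₂ x∈C = inj₂ (inj₁ x∈C)

walk-head : ∀ {n} {E : Fin n → Fin n → Set} {P : Fin n → Set} {u w} → Walk E P u w → P u
walk-head (here Pu)     = Pu
walk-head (step Pu _ _) = Pu

walk-closed : ∀ {n} {E : Fin n → Fin n → Set} {P S : Fin n → Set} →
  (∀ {a b} → S a → E a b → P b → S b) → ∀ {u w} → S u → Walk E P u w → S w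
walk-closed closed Su (here _)       = Su
walk-closed closed Su (step _ e walk) = walk-closed closed (closed Su e (walk-head walk)) walk

module _ {n : ℕ} {G : Graph n} (H : Subgraph G) {W A C D : Subset n}
         (W≡A⊎C⊎D : DisjointUnion W A C D) (V⊆W : V H ⊆ W)
         (A↮D : ∀ u v → u ∈ A → v ∈ D → ¬ Adj G u v) where

  private
    A∩C≡⊥ = let (_ , eq , _) = W≡A⊎C⊎D in eq
    A∩D≡⊥ = let (_ , _ , eq , _) = W≡A⊎C⊎D in eq
    C∩D≡⊥ = let (_ , _ , _ , eq) = W≡A⊎C⊎D in eq

  walk-avoiding-separator-stays-in-A : ∀ {u w} → u ∈ A →
    Walk (E H) (λ x → x ∉ C ∩ V H) u w → w ∈ A
  walk-avoiding-separator-stays-in-A = walk-closed closed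
    where
    closed : ∀ {a b} → a ∈ A → E H a b → b ∉ C ∩ V H → b ∈ A
    closed a∈A e b∉C∩V with E⊆ H e
    ... | _ , b∈V , adj with ∈-disjointUnion⁻ W≡A⊎C⊎D (V⊆W b∈V)
    ...   | inj₁ b∈A        = b∈A
    ...   | inj₂ (inj₁ b∈C) = contradiction (x∈p∩q⁺ (b∈C , b∈V)) b∉C∩V
    ...   | inj₂ (inj₂ b∈D) = contradiction adj (A↮D _ _ a∈A b∈D)

  separator-isVertexCut : ∀ {u v} → u ∈ V H → u ∈ A → v ∈ V H → v ∈ D →
    IsVertexCut H (C ∩ V H)
  separator-isVertexCut {u} {v} u∈V u∈A v∈V v∈D =
    p∩q⊆q C (V H) , u , v ,
    u∈V , (λ u∈C∩V → disjoint⇒∉ A∩C≡⊥ u∈A (p∩q⊆p C (V H) u∈C∩V)) ,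
    v∈V , (λ v∈C∩V → disjoint⇒∉ C∩D≡⊥ (p∩q⊆p C (V H) v∈C∩V) v∈D) ,
    (λ walk → disjoint⇒∉ A∩D≡⊥ (walk-avoiding-separator-stays-in-A u∈A walk) v∈D)

  module _ {k : ℕ} (H-kConnected : KConnected k H) (∣C∣≤k-1 : ∣ C ∣ ≤ k ∸ 1) where

    kConnected-avoids-A-or-D : ∀ {u v} → u ∈ V H → u ∈ A → v ∈ V H → v ∈ D → Empty.⊥
    kConnected-avoids-A-or-D u∈V u∈A v∈V v∈D =
      let (_ , no-small-cut) = H-kConnected in
      no-small-cut (C ∩ V H) (separator-isVertexCut u∈V u∈A v∈V v∈D)
        (≤-trans (∣p∩q∣≤∣p∣ C (V H)) ∣C∣≤k-1)

    kConnected-⊆-C∪D : ∣ A ∣ + ∣ C ∣ < ∣ V H ∣ → V H ⊆ C ∪ D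
    kConnected-⊆-C∪D ∣A∣+∣C∣<∣V∣ {x} x∈V with ∈-disjointUnion⁻ W≡A⊎C⊎D (V⊆W x∈V)
    ... | inj₂ (inj₁ x∈C) = x∈p∪q⁺ (inj₁ x∈C)
    ... | inj₂ (inj₂ x∈D) = x∈p∪q⁺ (inj₂ x∈D)
    ... | inj₁ x∈A = Empty.⊥-elim
          (<⇒≱ ∣A∣+∣C∣<∣V∣ (≤-trans (p⊆q⇒∣p∣≤∣q∣ V⊆A∪C) (∣p∪q∣≤∣p∣+∣q∣ A C)))
      where
      V⊆A∪C : V H ⊆ A ∪ C
      V⊆A∪C y∈V with ∈-disjointUnion⁻ W≡A⊎C⊎D (V⊆W y∈V)
      ... | inj₁ y∈A        = x∈p∪q⁺ (inj₁ y∈A)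
      ... | inj₂ (inj₁ y∈C) = x∈p∪q⁺ (inj₂ y∈C)
      ... | inj₂ (inj₂ y∈D) = Empty.⊥-elim (kConnected-avoids-A-or-D x∈V x∈A y∈V y∈D)

lemma2 : (k : ℕ) → 1 ≤ k → (f n : ℕ) → (G : Graph n) → f + k ≤ n →
    Σ (Decomposition G f k) IsStrong →
    ¬ (Σ (Subgraph G) λ H → KConnected k H × n ∸ f ≤ ∣ V H ∣)
lemma2 k _ f n G _ (Δ , strong) (H , H-kConnected , n-f≤∣V∣) =
  <⇒≱ (c6 Δ) (≤-trans n-f≤∣V∣
    (≤-trans (p⊆q⇒∣p∣≤∣q∣ (V⊆C∪D (l Δ) (1≤l Δ) ≤-refl)) (∣p∪q∣≤∣p∣+∣q∣ (C Δ (l Δ)) (D Δ (l Δ)))))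
  where
  V⊆C∪D-from : ∀ i → 1 ≤ i → i ≤ l Δ → {W : Subset n} →
    DisjointUnion W (A Δ i) (C Δ i) (D Δ i) → V H ⊆ W → V H ⊆ C Δ i ∪ D Δ i
  V⊆C∪D-from i 1≤i i≤l W≡A⊎C⊎D V⊆W =
    let (_ , _ , A↮D) = c4 Δ i 1≤i i≤l in
    kConnected-⊆-C∪D H W≡A⊎C⊎D V⊆W A↮D H-kConnected (c3 Δ i 1≤i i≤l)
      (<-≤-trans (strong i 1≤i i≤l) n-f≤∣V∣)

  V⊆C∪D : ∀ i → 1 ≤ i → i ≤ l Δ → V H ⊆ C Δ i ∪ D Δ i
  V⊆C∪D 1               _ 1≤l = V⊆C∪D-from 1 (s≤s z≤n) 1≤l (c1 Δ) (λ _ → ∈⊤)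
  V⊆C∪D (suc (suc i)) _ i+2≤l =
    V⊆C∪D-from (suc (suc i)) (s≤s z≤n) i+2≤l (c2 Δ (suc i) (s≤s z≤n) i+2≤l)
      (V⊆C∪D (suc i) (s≤s z≤n) (≤-trans (n≤1+n _) i+2≤l))
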